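{- Let $m,n\ge 3$ be odd, coprime integers such that $q=2mn+1$ is a prime power. Let $X=C^{2n}=\{x_1,\dots,x_m\}$ be the subgroup of $\mathbb{F}_q^*$ of order $m$ and $Y=C^{2m}=\{y_1,\dots,y_n\}$ the subgroup of $\mathbb{F}_q^*$ of order $n$. Then the $m\times n$ matrix $A=(a_{i,j})$ with $a_{i,j}=x_iy_j$ is a rank-one Heffter array H$(m,n)$ over $\mathbb{F}_q$.
   Context: $C^e$ denotes the subgroup of index $e$ of the multiplicative group $\mathbb{F}_q^*$ of the field $\mathbb{F}_q$. A half-set of an additive group $G$ of odd order $2\ell+1$ is an $\ell$-subset $L$ with $L\cup -L=G\setminus\{0\}$. A Heffter array H$(m,n)$ over $\mathbb{F}_q$ (with $q=2mn+1$) is an $m\times n$ matrix over $\mathbb{F}_q$ whose entries form a half-set of the additive group of $\mathbb{F}_q$ and whose every row and every column sums to $0$; it is rank-one if its rank as a matrix over $\mathbb{F}_q$ is $1$. A pair $(m,n)$ is called admissible if $2mn+1$ is a prime power and $m,n>2$. -}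

module Defs where

open import Level using (0ℓ)
open import Data.Nat using (ℕ; zero; suc; _*_; _^_; _≤_)
open import Data.Nat.Primality using (Prime)
open import Data.Fin using (Fin)
import Data.Fin as Fin
open import Data.Product using (Σ; ∃; ∃-syntax; _×_; _,_)
open import Data.Sum using (_⊎_)
open import Relation.Binary.PropositionalEquality using (_≡_; _≢_)
open import Relation.Nullary using (¬_)
open import Algebra.Structures using (IsCommutativeRing)
open import Function.Bundles using (_↔_; _⇔_)

Odd : ℕ → Set
Odd m = ∃[ k ] m ≡ suc (2 * k)

IsPrimePower : ℕ → Set
IsPrimePower q = ∃[ p ] ∃[ k ] (Prime p × 1 ≤ k × q ≡ p ^ k)

record FiniteField (q : ℕ) : Set₁ where
  infixl 7 _·_
  infixl 6 _⊕_
  field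
    F     : Set
    _⊕_   : F → F → F
    _·_   : F → F → F
    ⊖_    : F → F
    0F    : F
    1F   : F
    isCommutativeRing : IsCommutativeRing _≡_ _⊕_ _·_ ⊖_ 0F 1F
    0≢1   : 0F ≢ 1F
    inv   : ∀ x → x ≢ 0F → ∃[ y ] (x · y ≡ 1F)
    enum  : F ↔ Fin q

module _ {q : ℕ} (𝔽 : FiniteField q) where
  open FiniteField 𝔽

  record IsSubgroupOfUnits (P : F → Set) : Set where
    field
      nonzero : ∀ {x} → P x → x ≢ 0F
      one     : P 1F
      mul     : ∀ {x y} → P x → P y → P (x · y)
      inverse : ∀ {x y} → P x → x · y ≡ 1F → P y

  -- x : Fin k → F lists the elements of P without repetition (so |P| = k)
  Enumerates : ∀ {k} → (F → Set) → (Fin k → F) → Set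
  Enumerates P x = (∀ {i j} → x i ≡ x j → i ≡ j) × (∀ a → P a ⇔ (∃[ i ] x i ≡ a))

  ∑ : ∀ k → (Fin k → F) → F
  ∑ zero    f = 0F
  ∑ (suc k) f = f Fin.zero ⊕ ∑ k (λ i → f (Fin.suc i))

  -- the entries of the m×n matrix A form a half-set of (F,+):
  -- the mn entries are pairwise distinct (so |L| = mn) and L ∪ -L = F \ {0}
  EntriesHalfSet : ∀ m n → (Fin m → Fin n → F) → Set
  EntriesHalfSet m n A =
    (∀ {i i' j j'} → A i j ≡ A i' j' → (i ≡ i' × j ≡ j'))
    × (∀ g → (g ≢ 0F) ⇔ (∃[ i ] ∃[ j ] (A i j ≡ g ⊎ A i j ≡ ⊖ g)))

  -- Heffter array H(m,n) over F (q = 2mn+1 is a hypothesis of the statement)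
  IsHeffter : ∀ m n → (Fin m → Fin n → F) → Set
  IsHeffter m n A =
    EntriesHalfSet m n A
    × (∀ i → ∑ n (λ j → A i j) ≡ 0F)
    × (∀ j → ∑ m (λ i → A i j) ≡ 0F)

  -- rank one: A ≠ 0, and the column space is spanned by a single vector u
  -- (i.e. the column space has dimension exactly 1)
  RankOne : ∀ m n → (Fin m → Fin n → F) → Set
  RankOne m n A =
    (∃[ i ] ∃[ j ] A i j ≢ 0F)
    × (Σ (Fin m → F) λ u → ∀ j → Σ F λ c → ∀ i → A i j ≡ c · u i)

module Submission where

-- Every x i · y j is a unit whose (mn)-th power is 1. The entries are distinct: x i · y j = x i' · y j'
-- puts x i / x i' = y j' / y j in X ∩ Y, whose elements have order dividing the coprime m and n.
-- No entry is the negative of another, because (-1)^(mn) = -1 ≠ 1 for odd mn in odd characteristic.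
-- So 0 and the ± x i · y j are 2mn + 1 = q distinct field elements, i.e. all of F, which is the
-- half-set property. Multiplying by any z ≠ 1 of a subgroup permutes it, so the subgroup sums to 0;
-- hence every row x i · Y and column X · y j sums to 0, and A = x yᵀ has rank one.

open import Defs
open import Data.Nat using (ℕ; suc; _*_; _≤_)
open import Data.Nat.Coprimality using (Coprime)
open import Data.Fin using (Fin)
open import Relation.Binary.PropositionalEquality using (_≡_)
open import Data.Product using (_×_)

open import Level using (0ℓ)
open import Algebra.Bundles using (CommutativeRing)
import Algebra.Properties.CommutativeMonoid.Sum as CommutativeMonoidSum
import Algebra.Properties.CommutativeSemigroup as CommutativeSemigroupProperties
import Algebra.Properties.CommutativeSemiring.Exp as CommutativeSemiringExp
import Algebra.Properties.Monoid.Mult as MonoidMult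
import Algebra.Properties.Ring as RingProperties
import Algebra.Properties.Semiring.Sum as SemiringSum
open import Data.Fin using (zero; suc)
import Data.Fin.Properties as Fin
open import Data.Fin.Permutation using (Permutation; permutation)
open import Data.Nat using (zero; _+_; s≤s)
import Data.Nat.Properties as ℕ
open import Data.Nat.Coprimality using (coprime⇒GCD≡1)
open import Data.Nat.GCD using (module Bézout)
open import Data.Product using (∃-syntax; _,_; proj₁; proj₂)
open import Data.Product.Function.NonDependent.Propositional using (_×-↔_)
open import Data.Sum using (_⊎_; inj₁; inj₂)
open import Data.Sum.Function.Propositional using (_⊎-↔_)
open import Data.Unit using (⊤; tt)
open import Data.Vec.Functional using (replicate)
open import Function.Base using (_∘_)
open import Function.Bundles using (_↔_; Inverse; Injection; Equivalence; mk⇔; mk↔ₛ′)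
open import Function.Definitions using (Injective)
open import Function.Properties.Inverse using (↔-refl; ↔-sym; ↔-trans; ↔⇒↣)
open import Relation.Binary.Definitions using (DecidableEquality)
open import Relation.Binary.PropositionalEquality
  using (_≢_; refl; sym; trans; cong; cong₂; subst; module ≡-Reasoning)
open import Relation.Nullary using (yes; no; contradiction)
open import Relation.Nullary.Decidable using (via-injection)

odd*odd : ∀ {m n} → Odd m → Odd n → Odd (m * n)
odd*odd (a , refl) (b , refl) =
  b + a * suc (2 * b) ,
  cong suc (trans (cong (2 * b +_) (ℕ.*-assoc 2 a _)) (sym (ℕ.*-distribˡ-+ 2 b _)))

Fin-1+2mn↔ : ∀ {q m n} → q ≡ suc (2 * m * n) → Fin q ↔ (Fin 1 ⊎ ((Fin 2 × Fin m) × Fin n))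
Fin-1+2mn↔ {m = m} {n} refl =
  ↔-trans (Fin.+↔⊎ {1}) (↔-refl ⊎-↔ ↔-trans (Fin.*↔× {2 * m}) (Fin.*↔× {2} ×-↔ ↔-refl))

module FieldProperties {q : ℕ} (𝔽 : FiniteField q) where
  open FiniteField 𝔽
  open ≡-Reasoning

  commutativeRing : CommutativeRing 0ℓ 0ℓ
  commutativeRing = record { isCommutativeRing = isCommutativeRing }

  open CommutativeRing commutativeRing
    using ( +-assoc; +-identityˡ; +-identityʳ; -‿inverseˡ; -‿inverseʳ; *-assoc; *-comm
          ; *-identityˡ; *-identityʳ; zeroˡ; zeroʳ; ring; semiring; commutativeSemiring; +-monoid
          ; *-commutativeMonoid; *-commutativeSemigroup )
  open RingProperties ring
    using (-1*x≈-x; -‿involutive; -‿injective; -0#≈0#; +-identityʳ-unique)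
  open CommutativeSemiringExp commutativeSemiring using (_^_; ^-assocʳ; ^-distrib-*)
  open SemiringSum semiring using (sum; sum-cong-≗; sum-permute; ∑-distrib-+; sum-replicate; *-distribˡ-sum)
  open CommutativeMonoidSum *-commutativeMonoid
    using ()
    renaming (sum to product; sum-cong-≗ to product-cong-≗; sum-permute to product-permute
             ; ∑-distrib-+ to ∏-distrib-*; sum-replicate to product-replicate)
  open MonoidMult +-monoid using (×-assocˡ) renaming (_×_ to _×ₙ_)
  open CommutativeSemigroupProperties *-commutativeSemigroup using () renaming (interchange to ·-interchange)

  module E = Inverse enum

  E-injective : Injective _≡_ _≡_ E.to
  E-injective = Injection.injective (↔⇒↣ enum)

  _≟_ : DecidableEquality F
  _≟_ = via-injection (↔⇒↣ enum) Fin._≟_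

  ∑≡sum : ∀ k (f : Fin k → F) → ∑ 𝔽 k f ≡ sum f
  ∑≡sum zero    f = refl
  ∑≡sum (suc k) f = cong (f zero ⊕_) (∑≡sum k (f ∘ suc))

  1≢0 : 1F ≢ 0F
  1≢0 = 0≢1 ∘ sym

  ·-cancelʳ : ∀ {a b c} → c ≢ 0F → a · c ≡ b · c → a ≡ b
  ·-cancelʳ {a} {b} {c} c≢0 ac≡bc with inv c c≢0
  ... | c⁻¹ , cc⁻¹≡1 = begin
    a                ≡⟨ sym (*-identityʳ a) ⟩
    a · 1F           ≡⟨ cong (a ·_) (sym cc⁻¹≡1) ⟩
    a · (c · c⁻¹)    ≡⟨ sym (*-assoc a c c⁻¹) ⟩
    (a · c) · c⁻¹    ≡⟨ cong (_· c⁻¹) ac≡bc ⟩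
    (b · c) · c⁻¹    ≡⟨ *-assoc b c c⁻¹ ⟩
    b · (c · c⁻¹)    ≡⟨ cong (b ·_) cc⁻¹≡1 ⟩
    b · 1F           ≡⟨ *-identityʳ b ⟩
    b                ∎

  ·-inverse-cancel : ∀ {u v} a → u · v ≡ 1F → u · (v · a) ≡ a
  ·-inverse-cancel {u} {v} a uv≡1 =
    trans (sym (*-assoc u v a)) (trans (cong (_· a) uv≡1) (*-identityˡ a))

  x·y≡y⇒x≡1 : ∀ {x y} → y ≢ 0F → x · y ≡ y → x ≡ 1F
  x·y≡y⇒x≡1 y≢0 xy≡y = ·-cancelʳ y≢0 (trans xy≡y (sym (*-identityˡ _)))

  ·-nonzero : ∀ {a b} → a ≢ 0F → b ≢ 0F → a · b ≢ 0F
  ·-nonzero {a} {b} a≢0 b≢0 ab≡0 =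
    a≢0 (·-cancelʳ b≢0 (trans ab≡0 (sym (zeroˡ b))))

  ⊖-nonzero : ∀ {a} → a ≢ 0F → ⊖ a ≢ 0F
  ⊖-nonzero a≢0 -a≡0 = a≢0 (trans (sym (-‿involutive _)) (trans (cong ⊖_ -a≡0) -0#≈0#))

  product-nonzero : ∀ {k} (f : Fin k → F) → (∀ i → f i ≢ 0F) → product f ≢ 0F
  product-nonzero {zero}  f f≢0 = 1≢0
  product-nonzero {suc k} f f≢0 = ·-nonzero (f≢0 zero) (product-nonzero (f ∘ suc) (f≢0 ∘ suc))

  1^n≡1 : ∀ n → 1F ^ n ≡ 1F
  1^n≡1 zero    = refl
  1^n≡1 (suc n) = trans (*-identityˡ _) (1^n≡1 n)

  n×0≡0 : ∀ n → n ×ₙ 0F ≡ 0F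
  n×0≡0 zero    = refl
  n×0≡0 (suc n) = trans (+-identityˡ _) (n×0≡0 n)

  ^≡1⇒^*≡1 : ∀ {z k} → z ^ k ≡ 1F → ∀ c → z ^ (c * k) ≡ 1F
  ^≡1⇒^*≡1 {z} {k} zᵏ≡1 c = begin
    z ^ (c * k)  ≡⟨ cong (z ^_) (ℕ.*-comm c k) ⟩
    z ^ (k * c)  ≡⟨ sym (^-assocʳ z k c) ⟩
    (z ^ k) ^ c  ≡⟨ cong (_^ c) zᵏ≡1 ⟩
    1F ^ c       ≡⟨ 1^n≡1 c ⟩
    1F           ∎

  ^≡1-bezout : ∀ {z k l} c d → suc (c * k) ≡ d * l → z ^ k ≡ 1F → z ^ l ≡ 1F → z ≡ 1F
  ^≡1-bezout {z} {k} {l} c d 1+ck≡dl zᵏ≡1 zˡ≡1 = begin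
    z                ≡⟨ sym (*-identityʳ z) ⟩
    z · 1F           ≡⟨ cong (z ·_) (sym (^≡1⇒^*≡1 zᵏ≡1 c)) ⟩
    z ^ suc (c * k)  ≡⟨ cong (z ^_) 1+ck≡dl ⟩
    z ^ (d * l)      ≡⟨ ^≡1⇒^*≡1 zˡ≡1 d ⟩
    1F               ∎

  ^≡1-coprime : ∀ {z k l} → Coprime k l → z ^ k ≡ 1F → z ^ l ≡ 1F → z ≡ 1F
  ^≡1-coprime k⊥l zᵏ≡1 zˡ≡1 with Bézout.identity (coprime⇒GCD≡1 k⊥l)
  ... | Bézout.+- a b 1+bl≡ak = ^≡1-bezout b a 1+bl≡ak zˡ≡1 zᵏ≡1
  ... | Bézout.-+ a b 1+ak≡bl = ^≡1-bezout a b 1+ak≡bl zᵏ≡1 zˡ≡1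

  -1^odd : ∀ {k} → Odd k → (⊖ 1F) ^ k ≡ ⊖ 1F
  -1^odd (t , refl) = begin
    ⊖ 1F · (⊖ 1F) ^ (2 * t)    ≡⟨ cong (⊖ 1F ·_) (sym (^-assocʳ (⊖ 1F) 2 t)) ⟩
    ⊖ 1F · ((⊖ 1F) ^ 2) ^ t    ≡⟨ cong (λ u → ⊖ 1F · u ^ t) -1²≡1 ⟩
    ⊖ 1F · 1F ^ t              ≡⟨ cong (⊖ 1F ·_) (1^n≡1 t) ⟩
    ⊖ 1F · 1F                  ≡⟨ *-identityʳ _ ⟩
    ⊖ 1F                       ∎
    where
    -1²≡1 : (⊖ 1F) ^ 2 ≡ 1F
    -1²≡1 = trans (cong (⊖ 1F ·_) (*-identityʳ _)) (trans (-1*x≈-x _) (-‿involutive 1F))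

  ≢-neg-of-roots : ∀ {N a b} → ⊖ 1F ≢ 1F → Odd N → a ^ N ≡ 1F → b ^ N ≡ 1F → a ≢ ⊖ b
  ≢-neg-of-roots {N} {a} {b} -1≢1 N-odd aᴺ≡1 bᴺ≡1 a≡-b = -1≢1 (begin
    ⊖ 1F                 ≡⟨ sym (*-identityʳ _) ⟩
    ⊖ 1F · 1F            ≡⟨ cong₂ _·_ (sym (-1^odd N-odd)) (sym bᴺ≡1) ⟩
    (⊖ 1F) ^ N · b ^ N   ≡⟨ sym (^-distrib-* (⊖ 1F) b N) ⟩
    (⊖ 1F · b) ^ N       ≡⟨ cong (_^ N) (trans (-1*x≈-x b) (sym a≡-b)) ⟩
    a ^ N                ≡⟨ aᴺ≡1 ⟩
    1F                   ∎)

  module Enumeration {k} {P : F → Set} {e : Fin k → F} (e-enumerates : Enumerates 𝔽 P e) where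
    e-injective : Injective _≡_ _≡_ e
    e-injective = proj₁ e-enumerates

    index : ∀ {a} → P a → Fin k
    index {a} p = proj₁ (Equivalence.to (proj₂ e-enumerates a) p)

    e-index : ∀ {a} (p : P a) → e (index p) ≡ a
    e-index {a} p = proj₂ (Equivalence.to (proj₂ e-enumerates a) p)

    member : ∀ i → P (e i)
    member i = Equivalence.from (proj₂ e-enumerates (e i)) (i , refl)

    module _ (σ : F ↔ F) (to-preserves : ∀ {a} → P a → P (Inverse.to σ a))
             (from-preserves : ∀ {a} → P a → P (Inverse.from σ a)) where
      private module σ = Inverse σ

      forward backward : Fin k → Fin k
      forward i = index (to-preserves (member i))
      backward i = index (from-preserves (member i))

      e-forward : ∀ i → e (forward i) ≡ σ.to (e i)
      e-forward i = e-index (to-preserves (member i))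

      e-backward : ∀ i → e (backward i) ≡ σ.from (e i)
      e-backward i = e-index (from-preserves (member i))

      reindex : Permutation k k
      reindex = permutation forward backward
        (λ i → e-injective (trans (e-forward _) (trans (cong σ.to (e-backward i)) (σ.strictlyInverseˡ (e i)))))
        (λ i → e-injective (trans (e-backward _) (trans (cong σ.from (e-forward i)) (σ.strictlyInverseʳ (e i)))))

      sum-reindex : sum e ≡ sum (σ.to ∘ e)
      sum-reindex = trans (sum-permute e reindex) (sum-cong-≗ e-forward)

      product-reindex : product e ≡ product (σ.to ∘ e)
      product-reindex = trans (product-permute e reindex) (product-cong-≗ e-forward)

  F-enumeration : Enumerates 𝔽 (λ _ → ⊤) E.from
  F-enumeration =
    Injection.injective (↔⇒↣ (↔-sym enum)) ,
    λ a → mk⇔ (λ _ → E.to a , E.strictlyInverseʳ a) (λ _ → tt)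

  translation : F → F ↔ F
  translation c = mk↔ₛ′ (_⊕ c) (_⊕ ⊖ c) (cancel (⊖ c) c (-‿inverseˡ c)) (cancel c (⊖ c) (-‿inverseʳ c))
    where
    cancel : ∀ c d → c ⊕ d ≡ 0F → ∀ a → (a ⊕ c) ⊕ d ≡ a
    cancel c d c+d≡0 a = trans (+-assoc a c d) (trans (cong (a ⊕_) c+d≡0) (+-identityʳ a))

  -- Adding 1 permutes F, so it leaves the sum of all elements unchanged.
  q×1≡0 : q ×ₙ 1F ≡ 0F
  q×1≡0 = +-identityʳ-unique S (q ×ₙ 1F) (sym (begin
    S                            ≡⟨ sum-reindex (translation 1F) (λ _ → tt) (λ _ → tt) ⟩
    sum (λ i → E.from i ⊕ 1F)    ≡⟨ ∑-distrib-+ E.from (replicate q 1F) ⟩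
    S ⊕ sum (replicate q 1F)     ≡⟨ cong (S ⊕_) (sum-replicate q) ⟩
    S ⊕ q ×ₙ 1F                  ∎))
    where
    open Enumeration F-enumeration
    S = sum E.from

  -1≢1 : Odd q → ⊖ 1F ≢ 1F
  -1≢1 (t , q≡1+2t) -1≡1 = 1≢0 (begin
    1F                   ≡⟨ sym (+-identityʳ 1F) ⟩
    1F ⊕ 0F              ≡⟨ cong (1F ⊕_) (sym 2t×1≡0) ⟩
    suc (2 * t) ×ₙ 1F    ≡⟨ cong (_×ₙ 1F) (sym q≡1+2t) ⟩
    q ×ₙ 1F              ≡⟨ q×1≡0 ⟩
    0F                   ∎)
    where
    2×1≡0 : 2 ×ₙ 1F ≡ 0F
    2×1≡0 = trans (cong (1F ⊕_) (trans (+-identityʳ 1F) (sym -1≡1))) (-‿inverseʳ 1F)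
    2t×1≡0 : (2 * t) ×ₙ 1F ≡ 0F
    2t×1≡0 = begin
      (2 * t) ×ₙ 1F    ≡⟨ cong (_×ₙ 1F) (ℕ.*-comm 2 t) ⟩
      (t * 2) ×ₙ 1F    ≡⟨ sym (×-assocˡ 1F t 2) ⟩
      t ×ₙ (2 ×ₙ 1F)   ≡⟨ cong (t ×ₙ_) 2×1≡0 ⟩
      t ×ₙ 0F          ≡⟨ n×0≡0 t ⟩
      0F               ∎

  module FiniteSubgroup {P : F → Set} (P-subgroup : IsSubgroupOfUnits 𝔽 P)
                        {k} {e : Fin k → F} (e-enumerates : Enumerates 𝔽 P e) where
    open IsSubgroupOfUnits P-subgroup
    open Enumeration e-enumerates public

    module _ {z} (z∈P : P z) where
      private
        z⁻¹ = proj₁ (inv z (nonzero z∈P))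
        zz⁻¹≡1 = proj₂ (inv z (nonzero z∈P))
        z⁻¹∈P = inverse z∈P zz⁻¹≡1

      scaling : F ↔ F
      scaling = mk↔ₛ′ (z ·_) (z⁻¹ ·_)
        (λ a → ·-inverse-cancel a zz⁻¹≡1)
        (λ a → ·-inverse-cancel a (trans (*-comm z⁻¹ z) zz⁻¹≡1))

      sum-scaled : sum e ≡ sum (λ i → z · e i)
      sum-scaled = sum-reindex scaling (mul z∈P) (mul z⁻¹∈P)

      product-scaled : product e ≡ product (λ i → z · e i)
      product-scaled = product-reindex scaling (mul z∈P) (mul z⁻¹∈P)

    ^-order≡1 : ∀ {z} → P z → z ^ k ≡ 1F
    ^-order≡1 {z} z∈P = x·y≡y⇒x≡1 (product-nonzero e (nonzero ∘ member)) (begin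
      z ^ k · product e                        ≡⟨ cong (_· product e) (sym (product-replicate k)) ⟩
      product (replicate k z) · product e      ≡⟨ sym (∏-distrib-* (replicate k z) e) ⟩
      product (λ i → z · e i)                  ≡⟨ sym (product-scaled z∈P) ⟩
      product e                                ∎)

    ∃≢1 : 2 ≤ k → ∃[ i ] e i ≢ 1F
    ∃≢1 (s≤s (s≤s _)) with e zero ≟ 1F
    ... | no e₀≢1 = zero , e₀≢1
    ... | yes e₀≡1 = suc zero , λ e₁≡1 → Fin.0≢1+n (e-injective (trans e₀≡1 (sym e₁≡1)))

    sum≡0 : 2 ≤ k → sum e ≡ 0F
    sum≡0 2≤k with sum e ≟ 0F | ∃≢1 2≤k
    ... | yes S≡0 | _        = S≡0
    ... | no S≢0  | i , eᵢ≢1 = contradiction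
      (x·y≡y⇒x≡1 S≢0 (trans (*-distribˡ-sum (e i) e) (sym (sum-scaled (member i)))))
      eᵢ≢1

  injective⇒surjective : ∀ {D : Set} → Fin q ↔ D → (f : D → F) → Injective _≡_ _≡_ f
                       → ∀ b → ∃[ d ] f d ≡ b
  injective⇒surjective Fin↔D f f-injective b with Fin.any? (λ i → f (Inverse.to Fin↔D i) ≟ b)
  ... | yes (i , fi≡b) = Inverse.to Fin↔D i , fi≡b
  ... | no b∉image = contradiction (Fin.injective⇒≤ g-injective) ℕ.1+n≰n
    where
    g : Fin (suc q) → Fin q
    g zero    = E.to b
    g (suc i) = E.to (f (Inverse.to Fin↔D i))

    g-injective : Injective _≡_ _≡_ g
    g-injective {zero}  {zero}  _  = refl
    g-injective {zero}  {suc j} eq = contradiction (j , sym (E-injective eq)) b∉image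
    g-injective {suc i} {zero}  eq = contradiction (i , E-injective eq) b∉image
    g-injective {suc i} {suc j} eq =
      cong suc (Injection.injective (↔⇒↣ Fin↔D) (f-injective (E-injective eq)))

  signed : Fin 2 → F → F
  signed zero       a = a
  signed (suc zero) a = ⊖ a

  signed-nonzero : ∀ s {a} → a ≢ 0F → signed s a ≢ 0F
  signed-nonzero zero       a≢0 = a≢0
  signed-nonzero (suc zero) a≢0 = ⊖-nonzero a≢0

  signed-cancel : ∀ s s' {a a'} → a ≢ ⊖ a' → a' ≢ ⊖ a → signed s a ≡ signed s' a' → s ≡ s' × a ≡ a'
  signed-cancel zero       zero       _      _      a≡a'   = refl , a≡a'
  signed-cancel zero       (suc zero) a≢-a' _      a≡-a'  = contradiction a≡-a' a≢-a'
  signed-cancel (suc zero) zero       _      a'≢-a -a≡a'  = contradiction (sym -a≡a') a'≢-a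
  signed-cancel (suc zero) (suc zero) _      _      -a≡-a' = refl , -‿injective -a≡-a'

  entries-halfSet : ∀ {m n} → q ≡ suc (2 * m * n) → (A : Fin m → Fin n → F)
    → (∀ {i i' j j'} → A i j ≡ A i' j' → i ≡ i' × j ≡ j')
    → (∀ i j → A i j ≢ 0F)
    → (∀ i j i' j' → A i j ≢ ⊖ A i' j')
    → EntriesHalfSet 𝔽 m n A
  entries-halfSet {m} {n} q≡1+2mn A A-injective A-nonzero A≢-A =
    A-injective , λ g → mk⇔ (entry-of g) (nonzero-entry g)
    where
    entry : Fin 1 ⊎ ((Fin 2 × Fin m) × Fin n) → F
    entry (inj₁ _)               = 0F
    entry (inj₂ ((s , i) , j)) = signed s (A i j)

    entry-injective : Injective _≡_ _≡_ entry
    entry-injective {inj₁ zero} {inj₁ zero} _ = refl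
    entry-injective {inj₁ _} {inj₂ ((s , i) , j)} eq = contradiction (sym eq) (signed-nonzero s (A-nonzero i j))
    entry-injective {inj₂ ((s , i) , j)} {inj₁ _} eq = contradiction eq (signed-nonzero s (A-nonzero i j))
    entry-injective {inj₂ ((s , i) , j)} {inj₂ ((s' , i') , j')} eq
      with refl , Aij≡Ai'j' ← signed-cancel s s' (A≢-A i j i' j') (A≢-A i' j' i j) eq
      with refl , refl ← A-injective Aij≡Ai'j' = refl

    entry-of : ∀ g → g ≢ 0F → ∃[ i ] ∃[ j ] (A i j ≡ g ⊎ A i j ≡ ⊖ g)
    entry-of g g≢0 with injective⇒surjective (Fin-1+2mn↔ q≡1+2mn) entry entry-injective g
    ... | inj₁ _ , 0≡g = contradiction (sym 0≡g) g≢0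
    ... | inj₂ ((zero , i) , j) , Aij≡g = i , j , inj₁ Aij≡g
    ... | inj₂ ((suc zero , i) , j) , -Aij≡g =
      i , j , inj₂ (trans (sym (-‿involutive _)) (cong ⊖_ -Aij≡g))

    nonzero-entry : ∀ g → ∃[ i ] ∃[ j ] (A i j ≡ g ⊎ A i j ≡ ⊖ g) → g ≢ 0F
    nonzero-entry g (i , j , inj₁ Aij≡g)  g≡0 = A-nonzero i j (trans Aij≡g g≡0)
    nonzero-entry g (i , j , inj₂ Aij≡-g) g≡0 = A-nonzero i j (trans Aij≡-g (trans (cong ⊖_ g≡0) -0#≈0#))

  module OuterProduct
    {X Y : F → Set} (X-subgroup : IsSubgroupOfUnits 𝔽 X) (Y-subgroup : IsSubgroupOfUnits 𝔽 Y)
    {m n} {x : Fin m → F} {y : Fin n → F} (x-enumerates : Enumerates 𝔽 X x) (y-enumerates : Enumerates 𝔽 Y y)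
    where
    private
      module X = FiniteSubgroup X-subgroup x-enumerates
      module Y = FiniteSubgroup Y-subgroup y-enumerates

    A : Fin m → Fin n → F
    A i j = x i · y j

    A-nonzero : ∀ i j → A i j ≢ 0F
    A-nonzero i j = ·-nonzero (nonzero X-subgroup (X.member i)) (nonzero Y-subgroup (Y.member j))
      where open IsSubgroupOfUnits

    X∩Y⊆1 : Coprime m n → ∀ {z} → X z → Y z → z ≡ 1F
    X∩Y⊆1 m⊥n z∈X z∈Y = ^≡1-coprime m⊥n (X.^-order≡1 z∈X) (Y.^-order≡1 z∈Y)

    A-injective : Coprime m n → ∀ {i i' j j'} → A i j ≡ A i' j' → i ≡ i' × j ≡ j'
    A-injective m⊥n {i} {i'} {j} {j'} Aij≡Ai'j' = X.e-injective xᵢ≡xᵢ' , Y.e-injective yⱼ≡yⱼ'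
      where
      open IsSubgroupOfUnits
      v = proj₁ (inv (x i') (nonzero X-subgroup (X.member i')))
      xᵢ'v≡1 = proj₂ (inv (x i') (nonzero X-subgroup (X.member i')))
      u = proj₁ (inv (y j) (nonzero Y-subgroup (Y.member j)))
      yⱼu≡1 = proj₂ (inv (y j) (nonzero Y-subgroup (Y.member j)))

      xᵢv≡yⱼ'u : x i · v ≡ y j' · u
      xᵢv≡yⱼ'u = begin
        x i · v                   ≡⟨ sym (*-identityʳ _) ⟩
        (x i · v) · 1F            ≡⟨ cong ((x i · v) ·_) (sym yⱼu≡1) ⟩
        (x i · v) · (y j · u)     ≡⟨ ·-interchange _ _ _ _ ⟩
        (x i · y j) · (v · u)     ≡⟨ cong (_· (v · u)) Aij≡Ai'j' ⟩
        (x i' · y j') · (v · u)   ≡⟨ ·-interchange _ _ _ _ ⟩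
        (x i' · v) · (y j' · u)   ≡⟨ cong (_· (y j' · u)) xᵢ'v≡1 ⟩
        1F · (y j' · u)           ≡⟨ *-identityˡ _ ⟩
        y j' · u                  ∎

      xᵢv≡1 : x i · v ≡ 1F
      xᵢv≡1 = X∩Y⊆1 m⊥n
        (mul X-subgroup (X.member i) (inverse X-subgroup (X.member i') xᵢ'v≡1))
        (subst Y (sym xᵢv≡yⱼ'u) (mul Y-subgroup (Y.member j') (inverse Y-subgroup (Y.member j) yⱼu≡1)))

      xᵢ≡xᵢ' : x i ≡ x i'
      xᵢ≡xᵢ' = ·-cancelʳ (nonzero X-subgroup (inverse X-subgroup (X.member i') xᵢ'v≡1))
                         (trans xᵢv≡1 (sym xᵢ'v≡1))

      yⱼ≡yⱼ' : y j ≡ y j'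
      yⱼ≡yⱼ' = ·-cancelʳ (nonzero X-subgroup (X.member i))
        (trans (*-comm (y j) (x i)) (trans Aij≡Ai'j' (trans (cong (_· y j') (sym xᵢ≡xᵢ')) (*-comm (x i) (y j')))))

    A^mn≡1 : ∀ i j → A i j ^ (m * n) ≡ 1F
    A^mn≡1 i j = begin
      (x i · y j) ^ (m * n)              ≡⟨ ^-distrib-* (x i) (y j) (m * n) ⟩
      x i ^ (m * n) · y j ^ (m * n)      ≡⟨ cong₂ _·_ xᵢ^mn≡1 (^≡1⇒^*≡1 (Y.^-order≡1 (Y.member j)) m) ⟩
      1F · 1F                            ≡⟨ *-identityˡ 1F ⟩
      1F                                 ∎
      where
      xᵢ^mn≡1 : x i ^ (m * n) ≡ 1F
      xᵢ^mn≡1 = trans (cong (x i ^_) (ℕ.*-comm m n)) (^≡1⇒^*≡1 (X.^-order≡1 (X.member i)) n)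

    A≢-A : Odd q → Odd m → Odd n → ∀ i j i' j' → A i j ≢ ⊖ A i' j'
    A≢-A q-odd m-odd n-odd i j i' j' =
      ≢-neg-of-roots (-1≢1 q-odd) (odd*odd m-odd n-odd) (A^mn≡1 i j) (A^mn≡1 i' j')

    row-sum≡0 : 2 ≤ n → ∀ i → ∑ 𝔽 n (A i) ≡ 0F
    row-sum≡0 2≤n i = begin
      ∑ 𝔽 n (A i)        ≡⟨ ∑≡sum n (A i) ⟩
      sum (A i)          ≡⟨ sym (*-distribˡ-sum (x i) y) ⟩
      x i · sum y        ≡⟨ cong (x i ·_) (Y.sum≡0 2≤n) ⟩
      x i · 0F           ≡⟨ zeroʳ (x i) ⟩
      0F                 ∎

    column-sum≡0 : 2 ≤ m → ∀ j → ∑ 𝔽 m (λ i → A i j) ≡ 0F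
    column-sum≡0 2≤m j = begin
      ∑ 𝔽 m (λ i → A i j)      ≡⟨ ∑≡sum m (λ i → A i j) ⟩
      sum (λ i → x i · y j)    ≡⟨ sum-cong-≗ (λ i → *-comm (x i) (y j)) ⟩
      sum (λ i → y j · x i)    ≡⟨ sym (*-distribˡ-sum (y j) x) ⟩
      y j · sum x              ≡⟨ cong (y j ·_) (X.sum≡0 2≤m) ⟩
      y j · 0F                 ≡⟨ zeroʳ (y j) ⟩
      0F                       ∎

    A-rankOne : Fin m → Fin n → RankOne 𝔽 m n A
    A-rankOne i j = (i , j , A-nonzero i j) , x , λ j′ → y j′ , λ i′ → *-comm (x i′) (y j′)

corollary1 : (m n q : ℕ) → 3 ≤ m → 3 ≤ n → Odd m → Odd n → Coprime m n
    → q ≡ suc (2 * m * n) → IsPrimePower q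
    → (𝔽 : FiniteField q)
    → (X Y : FiniteField.F 𝔽 → Set)
    → IsSubgroupOfUnits 𝔽 X → IsSubgroupOfUnits 𝔽 Y
    → (x : Fin m → FiniteField.F 𝔽) → Enumerates 𝔽 X x
    → (y : Fin n → FiniteField.F 𝔽) → Enumerates 𝔽 Y y
    → IsHeffter 𝔽 m n (λ i j → FiniteField._·_ 𝔽 (x i) (y j))
      × RankOne 𝔽 m n (λ i j → FiniteField._·_ 𝔽 (x i) (y j))
corollary1 m n q 3≤m@(s≤s _) 3≤n@(s≤s _) m-odd n-odd m⊥n q≡1+2mn _ 𝔽 X Y X-subgroup Y-subgroup
           x x-enumerates y y-enumerates =
  ( entries-halfSet q≡1+2mn A (A-injective m⊥n) A-nonzero (A≢-A q-odd m-odd n-odd)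
  , row-sum≡0 (ℕ.<⇒≤ 3≤n)
  , column-sum≡0 (ℕ.<⇒≤ 3≤m) )
  , A-rankOne zero zero
  where
  open FieldProperties 𝔽
  open OuterProduct X-subgroup Y-subgroup x-enumerates y-enumerates

  q-odd : Odd q
  q-odd = m * n , trans q≡1+2mn (cong suc (ℕ.*-assoc 2 m n))
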